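{- Let $M\models Th(\mathbb{N})$. If $c\in K_M$ and $c>0$, then there exists $d\in K_M$ with $c=d^2$.
   Context: For $M\models Th(\mathbb{N})$, $K_M$ is the ordered field of equivalence classes of $M$-reals: functions $M\to(-M\cup M)\times(M\setminus\{0\})$, $i\mapsto(a_i,b_i)$, definable in $M$ by $\mathfrak{L}_{PA}$-formulas with parameters from $M$, whose fraction sequence $x_i=a_i/b_i$ is Cauchy (for every $m\in M^{>0}$ there is $n$ with $m|x_{k_1}-x_{k_2}|<1$ for $k_1,k_2>n$), two being equivalent if for every $m\in M^{>0}$ eventually $m|x_k-y_k|<1$; operations are termwise and $[x]<[y]$ iff there are $m,k\in M$, $m>0$, with $mx_l+1<my_l$ for all $l>k$. -}

module Defs where

open import Data.Nat as ℕ using (ℕ)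
open import Data.Fin using (Fin)
open import Data.Vec using (Vec; []; _∷_; lookup)
open import Data.Bool using (Bool; true; false)
open import Data.Product using (Σ; _×_; _,_; proj₁; proj₂)
open import Data.Sum using (_⊎_)
open import Data.Empty using (⊥)
open import Relation.Binary.PropositionalEquality using (_≡_)
open import Relation.Nullary using (¬_)

data Term (n : ℕ) : Set where
  var  : Fin n → Term n
  zer  : Term n
  one  : Term n
  _⊕_  : Term n → Term n → Term n
  _⊗_  : Term n → Term n → Term n

data Formula (n : ℕ) : Set where
  _≐_  : Term n → Term n → Formula n
  _≺_  : Term n → Term n → Formula n
  ⊥f   : Formula n
  _∧f_ : Formula n → Formula n → Formula n
  _∨f_ : Formula n → Formula n → Formula n
  _⇒f_ : Formula n → Formula n → Formula n
  ∀f   : Formula (ℕ.suc n) → Formula n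
  ∃f   : Formula (ℕ.suc n) → Formula n

Sentence : Set
Sentence = Formula 0

record Structure : Set₁ where
  field
    Carrier : Set
    𝟘 𝟙     : Carrier
    _+_ _*_ : Carrier → Carrier → Carrier
    _<_     : Carrier → Carrier → Set

module Semantics (M : Structure) where
  open Structure M

  ⟦_⟧ : ∀ {n} → Term n → Vec Carrier n → Carrier
  ⟦ var x ⟧ ρ = lookup ρ x
  ⟦ zer ⟧ ρ = 𝟘
  ⟦ one ⟧ ρ = 𝟙
  ⟦ t ⊕ u ⟧ ρ = ⟦ t ⟧ ρ + ⟦ u ⟧ ρ
  ⟦ t ⊗ u ⟧ ρ = ⟦ t ⟧ ρ * ⟦ u ⟧ ρ

  Sat : ∀ {n} → Formula n → Vec Carrier n → Set
  Sat (t ≐ u) ρ = ⟦ t ⟧ ρ ≡ ⟦ u ⟧ ρ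
  Sat (t ≺ u) ρ = ⟦ t ⟧ ρ < ⟦ u ⟧ ρ
  Sat ⊥f ρ = ⊥
  Sat (φ ∧f ψ) ρ = Sat φ ρ × Sat ψ ρ
  Sat (φ ∨f ψ) ρ = Sat φ ρ ⊎ Sat ψ ρ
  Sat (φ ⇒f ψ) ρ = Sat φ ρ → Sat ψ ρ
  Sat (∀f φ) ρ = (x : Carrier) → Sat φ (x ∷ ρ)
  Sat (∃f φ) ρ = Σ Carrier λ x → Sat φ (x ∷ ρ)

  _⊨_ : Sentence → Set
  _⊨_ σ = Sat σ []

ℕ-str : Structure
ℕ-str = record
  { Carrier = ℕ ; 𝟘 = 0 ; 𝟙 = 1 ; _+_ = ℕ._+_ ; _*_ = ℕ._*_ ; _<_ = ℕ._<_ }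

ModelsThℕ : Structure → Set
ModelsThℕ M = (σ : Sentence) → Semantics._⊨_ ℕ-str σ → Semantics._⊨_ M σ

module KM (M : Structure) where
  open Structure M
  open Semantics M

  -- Elements of -M ∪ M are represented canonically as (sign , magnitude),
  -- sign = true meaning negative (magnitude then nonzero).
  -- An entry of a fraction sequence is (sign , a , b), representing ±a/b.
  Entry : Set
  Entry = Bool × Carrier × Carrier

  FracSeq : Set
  FracSeq = Carrier → Entry

  -- sign bits encoded in M as 0 / 1 (for the definability condition)
  enc : Bool → Carrier
  enc false = 𝟘
  enc true  = 𝟙

  -- M-integers as formal differences p - n of elements of M (auxiliary,
  -- only used to express inequalities between M-rationals).
  ZM : Set
  ZM = Carrier × Carrier

  _+ᶻ_ : ZM → ZM → ZM
  (p , n) +ᶻ (p' , n') = (p + p') , (n + n')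

  _*ᶻ_ : ZM → ZM → ZM
  (p , n) *ᶻ (p' , n') = ((p * p') + (n * n')) , ((p * n') + (n * p'))

  -ᶻ_ : ZM → ZM
  -ᶻ (p , n) = n , p

  _<ᶻ_ : ZM → ZM → Set
  (p , n) <ᶻ (p' , n') = (p + n') < (p' + n)

  ι : Carrier → ZM
  ι a = a , 𝟘

  num : Entry → ZM
  num (false , a , b) = a , 𝟘
  num (true  , a , b) = 𝟘 , a

  den : Entry → Carrier
  den (_ , _ , b) = b

  -- m·|x - y| < 1 for the M-rationals x = num e / den e, y = num e' / den e'
  -- (denominators positive), cleared of denominators.
  CloseBy : Carrier → Entry → Entry → Set
  CloseBy m e e' =
    let D = ι m *ᶻ ((num e *ᶻ ι (den e')) +ᶻ (-ᶻ (num e' *ᶻ ι (den e))))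
        w = ι (den e * den e')
    in ((-ᶻ w) <ᶻ D) × (D <ᶻ w)

  -- m·x + 1 < m·y, cleared of denominators.
  LtBy : Carrier → Entry → Entry → Set
  LtBy m e e' =
    ((ι m *ᶻ (num e *ᶻ ι (den e'))) +ᶻ ι (den e * den e'))
      <ᶻ (ι m *ᶻ (num e' *ᶻ ι (den e)))

  Cauchy : FracSeq → Set
  Cauchy x = (m : Carrier) → 𝟘 < m → Σ Carrier λ n →
    (k₁ k₂ : Carrier) → n < k₁ → n < k₂ → CloseBy m (x k₁) (x k₂)

  _≈K_ : FracSeq → FracSeq → Set
  x ≈K y = (m : Carrier) → 𝟘 < m → Σ Carrier λ n →
    (k : Carrier) → n < k → CloseBy m (x k) (y k)

  _<K_ : FracSeq → FracSeq → Set
  x <K y = Σ Carrier λ m → Σ Carrier λ k → (𝟘 < m) ×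
    ((l : Carrier) → k < l → LtBy m (x l) (y l))

  Definable : FracSeq → Set
  Definable f = Σ ℕ λ k → Σ (Vec Carrier k) λ p → Σ (Formula (4 ℕ.+ k)) λ φ →
    (i : Carrier) (σ : Bool) (a b : Carrier) →
      (Sat φ (i ∷ enc σ ∷ a ∷ b ∷ p) → f i ≡ (σ , a , b)) ×
      (f i ≡ (σ , a , b) → Sat φ (i ∷ enc σ ∷ a ∷ b ∷ p))

  record MReal : Set where
    field
      seq       : FracSeq
      canonical : (i a b : Carrier) → seq i ≡ (true , a , b) → ¬ (a ≡ 𝟘)
      denNZ     : (i : Carrier) → ¬ (den (seq i) ≡ 𝟘)
      definable : Definable seq
      cauchy    : Cauchy seq
  open MReal public

  zeroSeq : FracSeq
  zeroSeq _ = false , 𝟘 , 𝟙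

  mulSeq : FracSeq → FracSeq → FracSeq
  mulSeq x y i with x i | y i
  ... | (s , a , b) | (s' , a' , b') = Data.Bool._xor_ s s' , a * a' , b * b'

-- Let c be represented by a_i/b_i, defined by a formula φ with parameters p. Put
-- N_i = (2a_i + 1)(i + 1) and d_i = ⌊√(a_i b_i N_i²)⌋ / (b_i N_i). Then d_i² is within
-- 1/(i + 1) of |a_i/b_i|, and since |d_i - d_j|² ≤ |d_i² - d_j²|, the d_i are Cauchy as soon
-- as the c_i are and eventually positive. Everything here speaks only about the relation
-- defined by φ, so "if φ defines a positive M-real with parameters p, then the formula
-- defining d defines an M-real whose square is equivalent to it" is one first-order sentence
-- (quantifying over p). It is true in ℕ by the arithmetic above, hence in every M ⊨ Th(ℕ).

module Submission where

open import Data.Bool using (Bool; true; false)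
open import Data.Bool.Properties using (xor-same)
open import Data.Empty using (⊥; ⊥-elim)
open import Data.Fin using (Fin; zero; suc; _↑ʳ_; lift; #_)
open import Data.Nat as ℕ using (ℕ; zero; suc)
open import Data.Product using (Σ; Σ-syntax; _×_; _,_; proj₁; proj₂)
open import Data.Product.Function.NonDependent.Propositional using (_×-⇔_)
open import Data.Sum using (_⊎_; inj₁; inj₂; [_,_]′)
open import Data.Sum.Function.Propositional using (_⊎-⇔_)
open import Data.Vec using (Vec; []; _∷_; _++_; lookup)
open import Data.Vec.Properties using (lookup-++ʳ)
open import Function.Bundles using (_⇔_; mk⇔; Equivalence)
open import Function.Construct.Composition using (_⇔-∘_)
open import Function.Construct.Identity using (⇔-id)
open import Function.Related.TypeIsomorphisms using (→-cong-⇔)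
open import Relation.Binary.PropositionalEquality
open import Relation.Nullary using (¬_)
open import Relation.Nullary.Decidable using (True)

open import Defs

open Equivalence using (to; from)

∀-⇔ : {A : Set} {B C : A → Set} → (∀ x → B x ⇔ C x) → ((x : A) → B x) ⇔ ((x : A) → C x)
∀-⇔ B⇔C = mk⇔ (λ f x → to (B⇔C x) (f x)) (λ f x → from (B⇔C x) (f x))

∃-⇔ : {A : Set} {B C : A → Set} → (∀ x → B x ⇔ C x) → Σ A B ⇔ Σ A C
∃-⇔ B⇔C = mk⇔ (λ (x , y) → x , to (B⇔C x) y) (λ (x , y) → x , from (B⇔C x) y)

bool-⇔ : {A C : Set} {B : Bool → Set} → A ⇔ B false → C ⇔ B true → (A × C) ⇔ (∀ σ → B σ)
bool-⇔ A⇔B C⇔B = mk⇔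
  (λ { (x , y) false → to A⇔B x ; (x , y) true → to C⇔B y })
  (λ h → from A⇔B (h false) , from C⇔B (h true))

⇒-⇔ : {A B C : Set} → B ⇔ C → (A → B) ⇔ (A → C)
⇒-⇔ = →-cong-⇔ (⇔-id _)

≡⇒⇔ : {A B : Set} → A ≡ B → A ⇔ B
≡⇒⇔ refl = ⇔-id _

renameTerm : ∀ {m n} → (Fin m → Fin n) → Term m → Term n
renameTerm f (var x) = var (f x)
renameTerm f zer = zer
renameTerm f one = one
renameTerm f (t ⊕ u) = renameTerm f t ⊕ renameTerm f u
renameTerm f (t ⊗ u) = renameTerm f t ⊗ renameTerm f u

renameFormula : ∀ {m n} → (Fin m → Fin n) → Formula m → Formula n
renameFormula f (t ≐ u) = renameTerm f t ≐ renameTerm f u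
renameFormula f (t ≺ u) = renameTerm f t ≺ renameTerm f u
renameFormula f ⊥f = ⊥f
renameFormula f (φ ∧f ψ) = renameFormula f φ ∧f renameFormula f ψ
renameFormula f (φ ∨f ψ) = renameFormula f φ ∨f renameFormula f ψ
renameFormula f (φ ⇒f ψ) = renameFormula f φ ⇒f renameFormula f ψ
renameFormula f (∀f φ) = ∀f (renameFormula (lift 1 f) φ)
renameFormula f (∃f φ) = ∃f (renameFormula (lift 1 f) φ)

var# : ∀ {n} m {m<n : True (suc m ℕ.≤? n)} → Term n
var# m {m<n} = var ((# m) {m<n = m<n})

∀closure : ∀ k → Formula k → Sentence
∀closure zero φ = φ
∀closure (suc k) φ = ∀closure k (∀f φ)

∀ⁿ : ∀ {n} j → Formula (j ℕ.+ n) → Formula n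
∀ⁿ zero φ = φ
∀ⁿ (suc j) φ = ∀ⁿ j (∀f φ)

⋀ : ∀ {n} → (Bool → Formula n) → Formula n
⋀ F = F false ∧f F true

-- χ ⟨ j ∣ i , s , a , b ⟩ reads χ, a formula in (i, s, a, b, parameters), at the variables
-- i, s, a, b of a context of j bound variables above the same parameters.
entryVars : ∀ {k n} → (i s a b : Fin n) → (Fin k → Fin n) → Fin (4 ℕ.+ k) → Fin n
entryVars i s a b params zero = i
entryVars i s a b params (suc zero) = s
entryVars i s a b params (suc (suc zero)) = a
entryVars i s a b params (suc (suc (suc zero))) = b
entryVars i s a b params (suc (suc (suc (suc t)))) = params t

infix 30 _⟨_∣_,_,_,_⟩
_⟨_∣_,_,_,_⟩ : ∀ {k} → Formula (4 ℕ.+ k) → ∀ j → (i s a b : Fin (j ℕ.+ k)) → Formula (j ℕ.+ k)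
χ ⟨ j ∣ i , s , a , b ⟩ = renameFormula (entryVars i s a b (j ↑ʳ_)) χ

-- Term-level copies of the arithmetic of KM: once the signs are constructors, Sat of
-- closeByᵀ and ltByᵀ unfolds definitionally to CloseBy and LtBy.
module _ {n : ℕ} where

  ZTerm : Set
  ZTerm = Term n × Term n

  _+ᵀ_ _*ᵀ_ : ZTerm → ZTerm → ZTerm
  (p , q) +ᵀ (p' , q') = (p ⊕ p') , (q ⊕ q')
  (p , q) *ᵀ (p' , q') = ((p ⊗ p') ⊕ (q ⊗ q')) , ((p ⊗ q') ⊕ (q ⊗ p'))

  -ᵀ_ : ZTerm → ZTerm
  -ᵀ (p , q) = q , p

  _<ᵀ_ : ZTerm → ZTerm → Formula n
  (p , q) <ᵀ (p' , q') = (p ⊕ q') ≺ (p' ⊕ q)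

  ιᵀ : Term n → ZTerm
  ιᵀ a = a , zer

  EntryTerm : Set
  EntryTerm = Bool × Term n × Term n

  numᵀ : EntryTerm → ZTerm
  numᵀ (false , a , b) = a , zer
  numᵀ (true , a , b) = zer , a

  denᵀ : EntryTerm → Term n
  denᵀ (_ , _ , b) = b

  closeByᵀ : Term n → EntryTerm → EntryTerm → Formula n
  closeByᵀ m e e' =
    ((-ᵀ w) <ᵀ D) ∧f (D <ᵀ w)
    where
    D w : ZTerm
    D = ιᵀ m *ᵀ ((numᵀ e *ᵀ ιᵀ (denᵀ e')) +ᵀ (-ᵀ (numᵀ e' *ᵀ ιᵀ (denᵀ e))))
    w = ιᵀ (denᵀ e ⊗ denᵀ e')

  ltByᵀ : Term n → EntryTerm → EntryTerm → Formula n
  ltByᵀ m e e' =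
    ((ιᵀ m *ᵀ (numᵀ e *ᵀ ιᵀ (denᵀ e'))) +ᵀ ιᵀ (denᵀ e ⊗ denᵀ e')) <ᵀ
    (ιᵀ m *ᵀ (numᵀ e' *ᵀ ιᵀ (denᵀ e)))

  encᵀ : Bool → Term n
  encᵀ false = zer
  encᵀ true = one

  signedCloseByᵀ : (m s a b s' a' b' : Fin n) → Formula n
  signedCloseByᵀ m s a b s' a' b' =
    ⋀ λ σ → (var s ≐ encᵀ σ) ⇒f ⋀ λ σ' → (var s' ≐ encᵀ σ') ⇒f
      closeByᵀ (var m) (σ , var a , var b) (σ' , var a' , var b')

  scaleᵀ : Term n → Term n → Term n
  scaleᵀ i a = ((a ⊕ a) ⊕ one) ⊗ (i ⊕ one)

  radicandᵀ : Term n → Term n → Term n → Term n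
  radicandᵀ i a b = ((a ⊗ b) ⊗ scaleᵀ i a) ⊗ scaleᵀ i a

  isSqrtEntryᵀ : (i ca cb a b : Term n) → Formula n
  isSqrtEntryᵀ i ca cb a b =
    (b ≐ (cb ⊗ scaleᵀ i ca)) ∧f
    ((((a ⊗ a) ≺ X) ∨f ((a ⊗ a) ≐ X)) ∧f (X ≺ ((a ⊕ one) ⊗ (a ⊕ one))))
    where
    X : Term n
    X = radicandᵀ i ca cb

-- χ(i, s, a, b) says that entry i of a sequence has sign code s (0 or 1) and value a/b;
-- var# 0 is the innermost bound variable.
module _ {k : ℕ} (χ : Formula (4 ℕ.+ k)) where

  totalF functionalF signBitsF negativesNonzeroF denominatorsNonzeroF cauchyF positiveF isMRealF : Formula k
  totalF = ∀f (∃f (∃f (∃f (χ ⟨ 4 ∣ # 3 , # 2 , # 1 , # 0 ⟩))))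
  functionalF = ∀ⁿ 7 (χ ⟨ 7 ∣ # 6 , # 5 , # 4 , # 3 ⟩ ⇒f (χ ⟨ 7 ∣ # 6 , # 2 , # 1 , # 0 ⟩ ⇒f
    ((var# 5 ≐ var# 2) ∧f ((var# 4 ≐ var# 1) ∧f (var# 3 ≐ var# 0)))))
  signBitsF = ∀ⁿ 4 (χ ⟨ 4 ∣ # 3 , # 2 , # 1 , # 0 ⟩ ⇒f ((var# 2 ≐ zer) ∨f (var# 2 ≐ one)))
  negativesNonzeroF =
    ∀ⁿ 4 (χ ⟨ 4 ∣ # 3 , # 2 , # 1 , # 0 ⟩ ⇒f ((var# 2 ≐ one) ⇒f ((var# 1 ≐ zer) ⇒f ⊥f)))
  denominatorsNonzeroF = ∀ⁿ 4 (χ ⟨ 4 ∣ # 3 , # 2 , # 1 , # 0 ⟩ ⇒f ((var# 0 ≐ zer) ⇒f ⊥f))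
  cauchyF = ∀f ((zer ≺ var# 0) ⇒f ∃f (∀f (∀f ((var# 2 ≺ var# 1) ⇒f ((var# 2 ≺ var# 0) ⇒f
    ∀ⁿ 6 (χ ⟨ 10 ∣ # 7 , # 5 , # 4 , # 3 ⟩ ⇒f (χ ⟨ 10 ∣ # 6 , # 2 , # 1 , # 0 ⟩ ⇒f
      signedCloseByᵀ (# 9) (# 5) (# 4) (# 3) (# 2) (# 1) (# 0))))))))
  positiveF = ∃f (∃f ((zer ≺ var# 1) ∧f ∀f ((var# 1 ≺ var# 0) ⇒f
    ∀ⁿ 3 (χ ⟨ 6 ∣ # 3 , # 2 , # 1 , # 0 ⟩ ⇒f
      ⋀ λ σ → (var# 2 ≐ encᵀ σ) ⇒f ltByᵀ (var# 5) (false , zer , one) (σ , var# 1 , var# 0)))))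
  isMRealF =
    totalF ∧f (functionalF ∧f (signBitsF ∧f (negativesNonzeroF ∧f (denominatorsNonzeroF ∧f cauchyF))))

  squareApproxF : Formula (4 ℕ.+ k) → Formula k
  squareApproxF δ = ∀f ((zer ≺ var# 0) ⇒f ∃f (∀f ((var# 1 ≺ var# 0) ⇒f
    ∀ⁿ 6 (χ ⟨ 9 ∣ # 6 , # 5 , # 4 , # 3 ⟩ ⇒f (δ ⟨ 9 ∣ # 6 , # 2 , # 1 , # 0 ⟩ ⇒f
      ⋀ λ σ → (var# 5 ≐ encᵀ σ) ⇒f
        closeByᵀ (var# 8) (σ , var# 4 , var# 3) (false , var# 1 ⊗ var# 1 , var# 0 ⊗ var# 0))))))

  -- d_i = ⌊√(a b N²)⌋ / (b N) with N = (2a + 1)(i + 1), for the entry a/b of χ at i.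
  sqrtF : Formula (4 ℕ.+ k)
  sqrtF = (var# 1 ≐ zer) ∧f ∃f (∃f (∃f (χ ⟨ 7 ∣ # 3 , # 2 , # 1 , # 0 ⟩ ∧f
    isSqrtEntryᵀ (var# 3) (var# 1) (var# 0) (var# 5) (var# 6))))

sqrtSentence : ∀ {k} → Formula (4 ℕ.+ k) → Sentence
sqrtSentence {k} χ =
  ∀closure k ((isMRealF χ ∧f positiveF χ) ⇒f (isMRealF (sqrtF χ) ∧f squareApproxF χ (sqrtF χ)))

module GraphSemantics (M : Structure) where
  open Structure M
  open Semantics M
  open KM M

  eval-rename : ∀ {m n} (f : Fin m → Fin n) {ρ : Vec Carrier m} {ρ' : Vec Carrier n} →
    (∀ x → lookup ρ' (f x) ≡ lookup ρ x) → (t : Term m) → ⟦ renameTerm f t ⟧ ρ' ≡ ⟦ t ⟧ ρ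
  eval-rename f h (var x) = h x
  eval-rename f h zer = refl
  eval-rename f h one = refl
  eval-rename f h (t ⊕ u) = cong₂ _+_ (eval-rename f h t) (eval-rename f h u)
  eval-rename f h (t ⊗ u) = cong₂ _*_ (eval-rename f h t) (eval-rename f h u)

  lookup-lift : ∀ {m n} (f : Fin m → Fin n) {ρ : Vec Carrier m} {ρ' : Vec Carrier n} →
    (∀ x → lookup ρ' (f x) ≡ lookup ρ x) → ∀ y x → lookup (y ∷ ρ') (lift 1 f x) ≡ lookup (y ∷ ρ) x
  lookup-lift f h y zero = refl
  lookup-lift f h y (suc x) = h x

  sat-rename : ∀ {m n} (f : Fin m → Fin n) {ρ : Vec Carrier m} {ρ' : Vec Carrier n} →
    (∀ x → lookup ρ' (f x) ≡ lookup ρ x) → (φ : Formula m) → Sat (renameFormula f φ) ρ' ⇔ Sat φ ρ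
  sat-rename f h (t ≐ u) = ≡⇒⇔ (cong₂ _≡_ (eval-rename f h t) (eval-rename f h u))
  sat-rename f h (t ≺ u) = ≡⇒⇔ (cong₂ _<_ (eval-rename f h t) (eval-rename f h u))
  sat-rename f h ⊥f = ⇔-id _
  sat-rename f h (φ ∧f ψ) = sat-rename f h φ ×-⇔ sat-rename f h ψ
  sat-rename f h (φ ∨f ψ) = sat-rename f h φ ⊎-⇔ sat-rename f h ψ
  sat-rename f h (φ ⇒f ψ) = →-cong-⇔ (sat-rename f h φ) (sat-rename f h ψ)
  sat-rename f h (∀f φ) = ∀-⇔ λ x → sat-rename (lift 1 f) (lookup-lift f h x) φ
  sat-rename f h (∃f φ) = ∃-⇔ λ x → sat-rename (lift 1 f) (lookup-lift f h x) φ

  sat-∀closure : ∀ k (φ : Formula k) → Sat (∀closure k φ) [] ⇔ ((p : Vec Carrier k) → Sat φ p)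
  sat-∀closure zero φ = mk⇔ (λ { h [] → h }) (λ h → h [])
  sat-∀closure (suc k) φ =
    mk⇔ (λ { h (x ∷ p) → h p x }) (λ h p x → h (x ∷ p)) ⇔-∘ sat-∀closure k (∀f φ)

  Rel₄ : Set₁
  Rel₄ = Carrier → Carrier → Carrier → Carrier → Set

  definedBy : ∀ {k} → Formula (4 ℕ.+ k) → Vec Carrier k → Rel₄
  definedBy χ p i s a b = Sat χ (i ∷ s ∷ a ∷ b ∷ p)

  sat-⟨⟩ : ∀ {k j} (χ : Formula (4 ℕ.+ k)) (ρ : Vec Carrier j) (p : Vec Carrier k) (i s a b : Fin (j ℕ.+ k)) →
    Sat (χ ⟨ j ∣ i , s , a , b ⟩) (ρ ++ p) ⇔
    definedBy χ p (lookup (ρ ++ p) i) (lookup (ρ ++ p) s) (lookup (ρ ++ p) a) (lookup (ρ ++ p) b)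
  sat-⟨⟩ χ ρ p i s a b = sat-rename _ agrees χ
    where
    agrees : ∀ x → lookup (ρ ++ p) (entryVars i s a b (_ ↑ʳ_) x) ≡ lookup (_ ∷ _ ∷ _ ∷ _ ∷ p) x
    agrees zero = refl
    agrees (suc zero) = refl
    agrees (suc (suc zero)) = refl
    agrees (suc (suc (suc zero))) = refl
    agrees (suc (suc (suc (suc t)))) = lookup-++ʳ ρ p t

  Total Functional SignBits NegativesNonzero DenominatorsNonzero CauchyGraph : Rel₄ → Set
  Total R = ∀ i → Σ[ s ∈ Carrier ] Σ[ a ∈ Carrier ] Σ[ b ∈ Carrier ] R i s a b
  Functional R = ∀ i s a b s' a' b' → R i s a b → R i s' a' b' → s ≡ s' × a ≡ a' × b ≡ b'
  SignBits R = ∀ i s a b → R i s a b → s ≡ 𝟘 ⊎ s ≡ 𝟙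
  NegativesNonzero R = ∀ i s a b → R i s a b → s ≡ 𝟙 → a ≡ 𝟘 → ⊥
  DenominatorsNonzero R = ∀ i s a b → R i s a b → b ≡ 𝟘 → ⊥
  CauchyGraph R = ∀ m → 𝟘 < m → Σ[ n ∈ Carrier ] ∀ k₁ k₂ → n < k₁ → n < k₂ →
    ∀ s a b s' a' b' → R k₁ s a b → R k₂ s' a' b' →
    ∀ σ → s ≡ enc σ → ∀ σ' → s' ≡ enc σ' → CloseBy m (σ , a , b) (σ' , a' , b')

  record IsMRealGraph (R : Rel₄) : Set where
    constructor isMRealGraph
    field
      total               : Total R
      functional          : Functional R
      signBits            : SignBits R
      negativesNonzero    : NegativesNonzero R
      denominatorsNonzero : DenominatorsNonzero R
      cauchyGraph         : CauchyGraph R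

  PositiveGraph : Rel₄ → Set
  PositiveGraph R = Σ[ m ∈ Carrier ] Σ[ n ∈ Carrier ] 𝟘 < m × ∀ l → n < l →
    ∀ s a b → R l s a b → ∀ σ → s ≡ enc σ → LtBy m (false , 𝟘 , 𝟙) (σ , a , b)

  SquareApproximates : Rel₄ → Rel₄ → Set
  SquareApproximates R D = ∀ m → 𝟘 < m → Σ[ n ∈ Carrier ] ∀ l → n < l →
    ∀ s a b s' a' b' → R l s a b → D l s' a' b' →
    ∀ σ → s ≡ enc σ → CloseBy m (σ , a , b) (false , a' * a' , b' * b')

  module _ {k : ℕ} (χ : Formula (4 ℕ.+ k)) (p : Vec Carrier k) where

    private
      R : Rel₄
      R = definedBy χ p

    sat-totalF : Sat (totalF χ) p ⇔ Total R
    sat-totalF = ∀-⇔ λ i → ∃-⇔ λ s → ∃-⇔ λ a → ∃-⇔ λ b → sat-⟨⟩ χ (b ∷ a ∷ s ∷ i ∷ []) p _ _ _ _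

    sat-functionalF : Sat (functionalF χ) p ⇔ Functional R
    sat-functionalF = ∀-⇔ λ i → ∀-⇔ λ s → ∀-⇔ λ a → ∀-⇔ λ b → ∀-⇔ λ s' → ∀-⇔ λ a' → ∀-⇔ λ b' →
      let ρ = b' ∷ a' ∷ s' ∷ b ∷ a ∷ s ∷ i ∷ [] in
      →-cong-⇔ (sat-⟨⟩ χ ρ p _ _ _ _) (→-cong-⇔ (sat-⟨⟩ χ ρ p _ _ _ _) (⇔-id _))

    sat-signBitsF : Sat (signBitsF χ) p ⇔ SignBits R
    sat-signBitsF = ∀-⇔ λ i → ∀-⇔ λ s → ∀-⇔ λ a → ∀-⇔ λ b →
      →-cong-⇔ (sat-⟨⟩ χ (b ∷ a ∷ s ∷ i ∷ []) p _ _ _ _) (⇔-id _)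

    sat-negativesNonzeroF : Sat (negativesNonzeroF χ) p ⇔ NegativesNonzero R
    sat-negativesNonzeroF = ∀-⇔ λ i → ∀-⇔ λ s → ∀-⇔ λ a → ∀-⇔ λ b →
      →-cong-⇔ (sat-⟨⟩ χ (b ∷ a ∷ s ∷ i ∷ []) p _ _ _ _) (⇔-id _)

    sat-denominatorsNonzeroF : Sat (denominatorsNonzeroF χ) p ⇔ DenominatorsNonzero R
    sat-denominatorsNonzeroF = ∀-⇔ λ i → ∀-⇔ λ s → ∀-⇔ λ a → ∀-⇔ λ b →
      →-cong-⇔ (sat-⟨⟩ χ (b ∷ a ∷ s ∷ i ∷ []) p _ _ _ _) (⇔-id _)

    sat-cauchyF : Sat (cauchyF χ) p ⇔ CauchyGraph R
    sat-cauchyF = ∀-⇔ λ m → ⇒-⇔ (∃-⇔ λ n → ∀-⇔ λ k₁ → ∀-⇔ λ k₂ → ⇒-⇔ (⇒-⇔ (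
      ∀-⇔ λ s → ∀-⇔ λ a → ∀-⇔ λ b → ∀-⇔ λ s' → ∀-⇔ λ a' → ∀-⇔ λ b' →
      let ρ = b' ∷ a' ∷ s' ∷ b ∷ a ∷ s ∷ k₂ ∷ k₁ ∷ n ∷ m ∷ [] in
      →-cong-⇔ (sat-⟨⟩ χ ρ p _ _ _ _) (→-cong-⇔ (sat-⟨⟩ χ ρ p _ _ _ _)
        (bool-⇔ (⇒-⇔ (bool-⇔ (⇔-id _) (⇔-id _))) (⇒-⇔ (bool-⇔ (⇔-id _) (⇔-id _))))))))

    sat-isMRealF : Sat (isMRealF χ) p ⇔ IsMRealGraph R
    sat-isMRealF = asRecord ⇔-∘
      (sat-totalF ×-⇔ sat-functionalF ×-⇔ sat-signBitsF ×-⇔ sat-negativesNonzeroF ×-⇔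
       sat-denominatorsNonzeroF ×-⇔ sat-cauchyF)
      where
      open IsMRealGraph
      asRecord : (Total R × Functional R × SignBits R × NegativesNonzero R × DenominatorsNonzero R ×
        CauchyGraph R) ⇔ IsMRealGraph R
      asRecord = mk⇔ (λ (t , f , s , n , d , c) → isMRealGraph t f s n d c)
        (λ G → total G , functional G , signBits G , negativesNonzero G , denominatorsNonzero G , cauchyGraph G)

    sat-positiveF : Sat (positiveF χ) p ⇔ PositiveGraph R
    sat-positiveF = ∃-⇔ λ m → ∃-⇔ λ n → ⇔-id _ ×-⇔ ∀-⇔ λ l → ⇒-⇔ (
      ∀-⇔ λ s → ∀-⇔ λ a → ∀-⇔ λ b →
      →-cong-⇔ (sat-⟨⟩ χ (b ∷ a ∷ s ∷ l ∷ n ∷ m ∷ []) p _ _ _ _) (bool-⇔ (⇔-id _) (⇔-id _)))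

    sat-squareApproxF : ∀ δ → Sat (squareApproxF χ δ) p ⇔ SquareApproximates R (definedBy δ p)
    sat-squareApproxF δ = ∀-⇔ λ m → ⇒-⇔ (∃-⇔ λ n → ∀-⇔ λ l → ⇒-⇔ (
      ∀-⇔ λ s → ∀-⇔ λ a → ∀-⇔ λ b → ∀-⇔ λ s' → ∀-⇔ λ a' → ∀-⇔ λ b' →
      let ρ = b' ∷ a' ∷ s' ∷ b ∷ a ∷ s ∷ l ∷ n ∷ m ∷ [] in
      →-cong-⇔ (sat-⟨⟩ χ ρ p _ _ _ _) (→-cong-⇔ (sat-⟨⟩ δ ρ p _ _ _ _) (bool-⇔ (⇔-id _) (⇔-id _)))))

  scale : Carrier → Carrier → Carrier
  scale i a = ((a + a) + 𝟙) * (i + 𝟙)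

  radicand : Carrier → Carrier → Carrier → Carrier
  radicand i a b = ((a * b) * scale i a) * scale i a

  IsSqrtEntry : (i ca cb a b : Carrier) → Set
  IsSqrtEntry i ca cb a b = b ≡ cb * scale i ca ×
    ((a * a) < radicand i ca cb ⊎ a * a ≡ radicand i ca cb) × radicand i ca cb < ((a + 𝟙) * (a + 𝟙))

  SqrtGraph : Rel₄ → Rel₄
  SqrtGraph R i s a b =
    s ≡ 𝟘 × Σ[ cs ∈ Carrier ] Σ[ ca ∈ Carrier ] Σ[ cb ∈ Carrier ] R i cs ca cb × IsSqrtEntry i ca cb a b

  sat-sqrtF : ∀ {k} (χ : Formula (4 ℕ.+ k)) (p : Vec Carrier k) i s a b →
    definedBy (sqrtF χ) p i s a b ⇔ SqrtGraph (definedBy χ p) i s a b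
  sat-sqrtF χ p i s a b = ⇔-id _ ×-⇔ ∃-⇔ λ cs → ∃-⇔ λ ca → ∃-⇔ λ cb →
    sat-⟨⟩ χ (cb ∷ ca ∷ cs ∷ i ∷ s ∷ a ∷ b ∷ []) p _ _ _ _ ×-⇔ ⇔-id _

  sat-sqrtSentence : ∀ {k} (χ : Formula (4 ℕ.+ k)) → Sat (sqrtSentence χ) [] ⇔
    ((p : Vec Carrier k) → IsMRealGraph (definedBy χ p) × PositiveGraph (definedBy χ p) →
      IsMRealGraph (definedBy (sqrtF χ) p) × SquareApproximates (definedBy χ p) (definedBy (sqrtF χ) p))
  sat-sqrtSentence {k} χ = (∀-⇔ λ p →
    →-cong-⇔ (sat-isMRealF χ p ×-⇔ sat-positiveF χ p) (sat-isMRealF (sqrtF χ) p ×-⇔ sat-squareApproxF χ p (sqrtF χ)))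
    ⇔-∘ sat-∀closure k _

module Graphs (M : Structure) where
  open Structure M
  open Semantics M
  open KM M
  open GraphSemantics M

  IsGraphOf : FracSeq → Rel₄ → Set
  IsGraphOf f R = ∀ i s a b → R i s a b ⇔ (Σ[ σ ∈ Bool ] s ≡ enc σ × f i ≡ (σ , a , b))

  record IsMRealSeq (f : FracSeq) : Set where
    field
      canonicalSigns      : (i a b : Carrier) → f i ≡ (true , a , b) → ¬ (a ≡ 𝟘)
      nonzeroDenominators : (i : Carrier) → ¬ (den (f i) ≡ 𝟘)
      cauchySeq           : Cauchy f

  open IsMRealSeq

  isMRealSeq : (c : MReal) → IsMRealSeq (seq c)
  isMRealSeq c = record { canonicalSigns = canonical c ; nonzeroDenominators = denNZ c ; cauchySeq = cauchy c }

  decodeSign : ∀ {s} → s ≡ 𝟘 ⊎ s ≡ 𝟙 → Σ[ σ ∈ Bool ] s ≡ enc σ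
  decodeSign (inj₁ s≡𝟘) = false , s≡𝟘
  decodeSign (inj₂ s≡𝟙) = true , s≡𝟙

  enc-bit : ∀ σ → enc σ ≡ 𝟘 ⊎ enc σ ≡ 𝟙
  enc-bit false = inj₁ refl
  enc-bit true = inj₂ refl

  mulSeq-self : ∀ {g : FracSeq} {i σ a b} → g i ≡ (σ , a , b) → mulSeq g g i ≡ (false , a * a , b * b)
  mulSeq-self {σ = σ} eq rewrite eq = cong (_, _) (xor-same σ)

  module _ {f : FracSeq} {R : Rel₄} (f-graph : IsGraphOf f R) where

    graph-at : ∀ {i σ a b} → f i ≡ (σ , a , b) → R i (enc σ) a b
    graph-at {σ = σ} eq = from (f-graph _ _ _ _) (σ , refl , eq)

  module _ (𝟘≢𝟙 : ¬ 𝟘 ≡ 𝟙) where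

    enc-injective : ∀ {σ σ'} → enc σ ≡ enc σ' → σ ≡ σ'
    enc-injective {false} {false} _ = refl
    enc-injective {false} {true} 𝟘≡𝟙 = ⊥-elim (𝟘≢𝟙 𝟘≡𝟙)
    enc-injective {true} {false} 𝟙≡𝟘 = ⊥-elim (𝟘≢𝟙 (sym 𝟙≡𝟘))
    enc-injective {true} {true} _ = refl

    module _ {f : FracSeq} {R : Rel₄} (f-graph : IsGraphOf f R) where

      graph-entry : ∀ {i s a b σ} → R i s a b → s ≡ enc σ → f i ≡ (σ , a , b)
      graph-entry r s≡encσ =
        let σ' , s≡encσ' , eq = to (f-graph _ _ _ _) r in
        subst (λ τ → _ ≡ (τ , _ , _)) (enc-injective (trans (sym s≡encσ') s≡encσ)) eq

      graph-isMRealGraph : IsMRealSeq f → IsMRealGraph R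
      graph-isMRealGraph f-real = isMRealGraph
        (λ i → _ , _ , _ , graph-at f-graph refl)
        (λ i s a b s' a' b' r r' → sameEntry (to (f-graph _ _ _ _) r) (to (f-graph _ _ _ _) r'))
        (λ i s a b r → let σ , s≡encσ , _ = to (f-graph _ _ _ _) r in
          subst (λ x → x ≡ 𝟘 ⊎ x ≡ 𝟙) (sym s≡encσ) (enc-bit σ))
        (λ i s a b r s≡𝟙 → canonicalSigns f-real i a b (graph-entry {σ = true} r s≡𝟙))
        (λ i s a b r b≡𝟘 → let _ , _ , eq = to (f-graph _ _ _ _) r in
          nonzeroDenominators f-real i (trans (cong den eq) b≡𝟘))
        (λ m 0<m → let n , close = cauchySeq f-real m 0<m in
          n , λ k₁ k₂ n<k₁ n<k₂ s a b s' a' b' r r' σ s≡encσ σ' s'≡encσ' →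
            subst₂ (CloseBy m) (graph-entry {σ = σ} r s≡encσ) (graph-entry {σ = σ'} r' s'≡encσ')
              (close k₁ k₂ n<k₁ n<k₂))
        where
        sameEntry : ∀ {i s a b s' a' b'} → Σ[ σ ∈ Bool ] s ≡ enc σ × f i ≡ (σ , a , b) →
          Σ[ σ ∈ Bool ] s' ≡ enc σ × f i ≡ (σ , a' , b') → s ≡ s' × a ≡ a' × b ≡ b'
        sameEntry (σ , s≡encσ , eq) (σ' , s'≡encσ' , eq') with trans (sym eq) eq'
        ... | refl = trans s≡encσ (sym s'≡encσ') , refl , refl

      positive⇔ : zeroSeq <K f ⇔ PositiveGraph R
      positive⇔ = mk⇔
        (λ (m , n , 0<m , lt) → m , n , 0<m , λ l n<l s a b r σ s≡encσ →
          subst (LtBy m (false , 𝟘 , 𝟙)) (graph-entry {σ = σ} r s≡encσ) (lt l n<l))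
        (λ (m , n , 0<m , lt) → m , n , 0<m , λ l n<l → lt l n<l _ _ _ (graph-at f-graph refl) (proj₁ (f l)) refl)

      squareApprox⇔ : ∀ {g D} → IsGraphOf g D → f ≈K mulSeq g g ⇔ SquareApproximates R D
      squareApprox⇔ {g} {D} g-graph = mk⇔ sound complete
        where
        sound : f ≈K mulSeq g g → SquareApproximates R D
        sound approx m 0<m = let n , close = approx m 0<m in
          n , λ l n<l s a b s' a' b' r d σ s≡encσ → let _ , _ , eq = to (g-graph _ _ _ _) d in
            subst₂ (CloseBy m) (graph-entry {σ = σ} r s≡encσ) (mulSeq-self {g = g} eq) (close l n<l)
        complete : SquareApproximates R D → f ≈K mulSeq g g
        complete approx m 0<m = let n , close = approx m 0<m in
          n , λ l n<l → subst (CloseBy m (f l)) (sym (mulSeq-self {g = g} {i = l} refl))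
            (close l n<l _ _ _ _ _ _ (graph-at f-graph refl) (graph-at g-graph refl) (proj₁ (f l)) refl)

    graph-definable : ∀ {f k} (χ : Formula (4 ℕ.+ k)) (p : Vec Carrier k) →
      IsGraphOf f (definedBy χ p) → Definable f
    graph-definable {k = k} χ p f-graph = k , p , χ , λ i σ a b →
      (λ r → graph-entry f-graph {σ = σ} r refl) , graph-at f-graph

    mreal : ∀ {f k} (χ : Formula (4 ℕ.+ k)) (p : Vec Carrier k) →
      IsGraphOf f (definedBy χ p) → IsMRealSeq f → MReal
    mreal {f} χ p f-graph f-real = record
      { seq = f
      ; canonical = canonicalSigns f-real
      ; denNZ = nonzeroDenominators f-real
      ; definable = graph-definable χ p f-graph
      ; cauchy = cauchySeq f-real
      }

  module GraphSequence {R : Rel₄} (G : IsMRealGraph R) where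
    open IsMRealGraph G

    entryOf : ∀ {i} → Σ[ s ∈ Carrier ] Σ[ a ∈ Carrier ] Σ[ b ∈ Carrier ] R i s a b → Entry
    entryOf {i} (s , a , b , r) = proj₁ (decodeSign (signBits i s a b r)) , a , b

    graphSeq : FracSeq
    graphSeq i = entryOf (total i)

    graphSeq-isGraph : IsGraphOf graphSeq R
    graphSeq-isGraph i s a b = mk⇔ (sound (total i)) (complete (total i))
      where
      sound : (t : Σ[ s ∈ Carrier ] Σ[ a ∈ Carrier ] Σ[ b ∈ Carrier ] R i s a b) →
        R i s a b → Σ[ σ ∈ Bool ] s ≡ enc σ × entryOf t ≡ (σ , a , b)
      sound (s₀ , a₀ , b₀ , r₀) r with functional i s₀ a₀ b₀ s a b r₀ r
      ... | refl , refl , refl = let σ , s≡encσ = decodeSign (signBits i s₀ a₀ b₀ r₀) in σ , s≡encσ , refl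
      complete : (t : Σ[ s ∈ Carrier ] Σ[ a ∈ Carrier ] Σ[ b ∈ Carrier ] R i s a b) →
        Σ[ σ ∈ Bool ] s ≡ enc σ × entryOf t ≡ (σ , a , b) → R i s a b
      complete (s₀ , a₀ , b₀ , r₀) (σ , s≡encσ , refl) =
        subst (λ x → R i x a b) (trans (decodeSign (signBits i s₀ a₀ b₀ r₀) .proj₂) (sym s≡encσ)) r₀

    graphSeq-isMRealSeq : IsMRealSeq graphSeq
    graphSeq-isMRealSeq = record
      { canonicalSigns = λ i a b eq → negativesNonzero i 𝟙 a b (graph-at graphSeq-isGraph eq) refl
      ; nonzeroDenominators = λ i → let s , a , b , r = total i in denominatorsNonzero i s a b r
      ; cauchySeq = λ m 0<m → let n , close = cauchyGraph m 0<m in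
          n , λ k₁ k₂ n<k₁ n<k₂ →
            close k₁ k₂ n<k₁ n<k₂ _ _ _ _ _ _ (graph-at graphSeq-isGraph refl) (graph-at graphSeq-isGraph refl)
              (proj₁ (graphSeq k₁)) refl (proj₁ (graphSeq k₂)) refl
      }

module SqrtEstimates where
  open import Data.Nat
  open import Data.Nat.Properties
  open import Data.Nat.Tactic.RingSolver using (solve-∀)
  open import Relation.Nullary using (yes; no)
  open import Relation.Binary.Definitions using (tri<; tri≈; tri>)
  open GraphSemantics ℕ-str using (scale; radicand)

  m*m<n*n⇒m<n : ∀ m n → m * m < n * n → m < n
  m*m<n*n⇒m<n m n m²<n² with m <? n
  ... | yes m<n = m<n
  ... | no m≮n = ⊥-elim (<⇒≱ m²<n² (*-mono-≤ (≮⇒≥ m≮n) (≮⇒≥ m≮n)))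

  record IsFloorSqrt (n r : ℕ) : Set where
    constructor isFloorSqrt
    field
      square≤     : r * r ≤ n
      <nextSquare : n < suc r * suc r

  open IsFloorSqrt

  floorSqrt : ∀ n → Σ[ r ∈ ℕ ] IsFloorSqrt n r
  floorSqrt zero = 0 , isFloorSqrt z≤n (s≤s z≤n)
  floorSqrt (suc n) with floorSqrt n
  ... | r , isFloorSqrt r²≤n n<[1+r]² with suc n <? suc r * suc r
  ...   | yes 1+n<[1+r]² = r , isFloorSqrt (m≤n⇒m≤1+n r²≤n) 1+n<[1+r]²
  ...   | no 1+n≮[1+r]² = suc r , isFloorSqrt (≮⇒≥ 1+n≮[1+r]²) (begin-strict
    suc n                   ≤⟨ n<[1+r]² ⟩
    suc r * suc r           <⟨ *-mono-< (n<1+n (suc r)) (n<1+n (suc r)) ⟩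
    suc (suc r) * suc (suc r) ∎)
    where open ≤-Reasoning

  ⌊√_⌋ : ℕ → ℕ
  ⌊√ n ⌋ = proj₁ (floorSqrt n)

  ⌊√⌋-isFloorSqrt : ∀ n → IsFloorSqrt n ⌊√ n ⌋
  ⌊√⌋-isFloorSqrt n = proj₂ (floorSqrt n)

  isFloorSqrt-unique : ∀ {n r r'} → IsFloorSqrt n r → IsFloorSqrt n r' → r ≡ r'
  isFloorSqrt-unique {r = r} {r'} (isFloorSqrt r²≤n n<[1+r]²) (isFloorSqrt r'²≤n n<[1+r']²) with <-cmp r r'
  ... | tri< r<r' _ _ = ⊥-elim (<⇒≱ n<[1+r]² (≤-trans (*-mono-≤ r<r' r<r') r'²≤n))
  ... | tri≈ _ r≡r' _ = r≡r'
  ... | tri> _ _ r>r' = ⊥-elim (<⇒≱ n<[1+r']² (≤-trans (*-mono-≤ r>r' r>r') r²≤n))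

  ∣m-n∣<o⇔ : ∀ m n o → ∣ m - n ∣ < o ⇔ (n < m + o × m < o + n)
  ∣m-n∣<o⇔ m n o = mk⇔ bounds fromBounds
    where
    open ≤-Reasoning
    bounds : ∣ m - n ∣ < o → n < m + o × m < o + n
    bounds ∣m-n∣<o =
      (begin-strict
        n             ≤⟨ m≤n+∣m-n∣ n m ⟩
        m + ∣ n - m ∣ ≡⟨ cong (m +_) (∣-∣-comm n m) ⟩
        m + ∣ m - n ∣ <⟨ +-monoʳ-< m ∣m-n∣<o ⟩
        m + o         ∎) ,
      (begin-strict m ≤⟨ m≤∣m-n∣+n m n ⟩ ∣ m - n ∣ + n <⟨ +-monoˡ-< n ∣m-n∣<o ⟩ o + n ∎)
    fromBounds : n < m + o × m < o + n → ∣ m - n ∣ < o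
    fromBounds (n<m+o , m<o+n) with ≤-total m n
    ... | inj₁ m≤n = subst (_< o) (sym (m≤n⇒∣m-n∣≡n∸m m≤n)) (+-cancelʳ-< m (n ∸ m) o (begin-strict
      n ∸ m + m ≡⟨ m∸n+n≡m m≤n ⟩ n <⟨ n<m+o ⟩ m + o ≡⟨ +-comm m o ⟩ o + m ∎))
    ... | inj₂ n≤m = subst (_< o) (sym (m≤n⇒∣n-m∣≡n∸m n≤m)) (+-cancelʳ-< n (m ∸ n) o (begin-strict
      m ∸ n + n ≡⟨ m∸n+n≡m n≤m ⟩ m <⟨ m<o+n ⟩ o + n ∎))

  ∣m-n∣*∣m-n∣≤∣m*m-n*n∣ : ∀ m n → ∣ m - n ∣ * ∣ m - n ∣ ≤ ∣ m * m - n * n ∣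
  ∣m-n∣*∣m-n∣≤∣m*m-n*n∣ m n = [ n≤m-case , m≤n-case ]′ (≤-total n m)
    where
    open ≤-Reasoning
    square-of-sum : ∀ n d → n * n + (d * d + 2 * n * d) ≡ (n + d) * (n + d)
    square-of-sum = solve-∀
    shifted : ∀ n d → ∣ n + d - n ∣ * ∣ n + d - n ∣ ≤ ∣ (n + d) * (n + d) - n * n ∣
    shifted n d = begin
      ∣ n + d - n ∣ * ∣ n + d - n ∣
        ≡⟨ cong (λ x → x * x) (trans (∣-∣-comm (n + d) n) (∣m-m+n∣≡n n d)) ⟩
      d * d                                         ≤⟨ m≤m+n (d * d) (2 * n * d) ⟩
      d * d + 2 * n * d                             ≡⟨ sym (∣m-m+n∣≡n (n * n) _) ⟩
      ∣ n * n - n * n + (d * d + 2 * n * d) ∣       ≡⟨ ∣-∣-comm (n * n) _ ⟩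
      ∣ n * n + (d * d + 2 * n * d) - n * n ∣       ≡⟨ cong (∣_- n * n ∣) (square-of-sum n d) ⟩
      ∣ (n + d) * (n + d) - n * n ∣                 ∎
    n≤m-case : n ≤ m → ∣ m - n ∣ * ∣ m - n ∣ ≤ ∣ m * m - n * n ∣
    n≤m-case n≤m = subst (λ m → ∣ m - n ∣ * ∣ m - n ∣ ≤ ∣ m * m - n * n ∣) (m+[n∸m]≡n n≤m) (shifted n (m ∸ n))
    m≤n-case : m ≤ n → ∣ m - n ∣ * ∣ m - n ∣ ≤ ∣ m * m - n * n ∣
    m≤n-case m≤n = subst₂ _≤_ (cong₂ _*_ (∣-∣-comm n m) (∣-∣-comm n m)) (∣-∣-comm (n * n) (m * m))
      (subst (λ n → ∣ n - m ∣ * ∣ n - m ∣ ≤ ∣ n * n - m * m ∣) (m+[n∸m]≡n m≤n) (shifted m (n ∸ m)))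

  ∣m-n∣≤∣m+s-[n+t]∣+[s+t] : ∀ m n s t → ∣ m - n ∣ ≤ ∣ m + s - (n + t) ∣ + (s + t)
  ∣m-n∣≤∣m+s-[n+t]∣+[s+t] m n s t = begin
    ∣ m - n ∣                                     ≤⟨ ∣-∣-triangle m (m + s) n ⟩
    ∣ m - m + s ∣ + ∣ m + s - n ∣                 ≤⟨ +-monoʳ-≤ ∣ m - m + s ∣ (∣-∣-triangle (m + s) (n + t) n) ⟩
    ∣ m - m + s ∣ + (∣ m + s - (n + t) ∣ + ∣ n + t - n ∣)
      ≡⟨ cong₂ (λ x y → x + (∣ m + s - (n + t) ∣ + y))
           (∣m-m+n∣≡n m s) (trans (∣-∣-comm (n + t) n) (∣m-m+n∣≡n n t)) ⟩
    s + (∣ m + s - (n + t) ∣ + t)                 ≡⟨ swap s ∣ m + s - (n + t) ∣ t ⟩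
    ∣ m + s - (n + t) ∣ + (s + t)                 ∎
    where
    open ≤-Reasoning
    swap : ∀ s d t → s + (d + t) ≡ d + (s + t)
    swap = solve-∀

  scale-nonZero : ∀ i A → NonZero (scale i A)
  scale-nonZero i A = >-nonZero (*-mono-≤ (m≤n+m 1 (A + A)) (m≤n+m 1 i))

  radicand-identity : ∀ i A B → B * radicand i A B ≡ A * ((B * scale i A) * (B * scale i A))
  radicand-identity i A B = identity A B (scale i A)
    where
    identity : ∀ A B N → B * (((A * B) * N) * N) ≡ A * ((B * N) * (B * N))
    identity = solve-∀

  floorSqrt-remainder : ∀ {n r} → IsFloorSqrt n r → n ∸ r * r ≤ r + r
  floorSqrt-remainder {n} {r} (isFloorSqrt _ n<[1+r]²) = begin
    n ∸ r * r                 ≤⟨ ∸-monoˡ-≤ (r * r) (s≤s⁻¹ (subst (n <_) (expand r) n<[1+r]²)) ⟩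
    (r * r + (r + r)) ∸ r * r ≡⟨ m+n∸m≡n (r * r) (r + r) ⟩
    r + r                     ∎
    where
    open ≤-Reasoning
    expand : ∀ r → suc r * suc r ≡ suc (r * r + (r + r))
    expand = solve-∀

  ⌊√radicand⌋-decomposition : ∀ i A B → let r = ⌊√ radicand i A B ⌋ in
    B * (r * r + (radicand i A B ∸ r * r)) ≡ A * ((B * scale i A) * (B * scale i A))
  ⌊√radicand⌋-decomposition i A B =
    trans (cong (B *_) (m+[n∸m]≡n (square≤ (⌊√⌋-isFloorSqrt (radicand i A B))))) (radicand-identity i A B)

  module _ (i A B : ℕ) .{{B≢0 : NonZero B}} where

    private
      N T X r : ℕ
      N = scale i A
      T = B * N
      X = radicand i A B
      r = ⌊√ X ⌋

    ⌊√radicand⌋-double< : r + r < ((A + A) + 1) * T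
    ⌊√radicand⌋-double< = m*m<n*n⇒m<n _ _ (begin-strict
      (r + r) * (r + r)           ≡⟨ quadruple r ⟩
      4 * (r * r)                 ≤⟨ *-monoʳ-≤ 4 (≤-trans (square≤ (⌊√⌋-isFloorSqrt X)) X≤AT²) ⟩
      4 * (A * (T * T))           <⟨ m<m+n _ (≤-trans (>-nonZero⁻¹ (T * T) {{T²≢0}}) (m≤m+n _ _)) ⟩
      4 * (A * (T * T)) + (T * T + 4 * (A * A * (T * T))) ≡⟨ square-of-sum A T ⟩
      (((A + A) + 1) * T) * (((A + A) + 1) * T) ∎)
      where
      open ≤-Reasoning
      T²≢0 : NonZero (T * T)
      T²≢0 = let T≢0 = m*n≢0 B N {{B≢0}} {{scale-nonZero i A}} in m*n≢0 T T {{T≢0}} {{T≢0}}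
      X≤AT² : X ≤ A * (T * T)
      X≤AT² = ≤-trans (m≤n*m X B) (≤-reflexive (radicand-identity i A B))
      quadruple : ∀ r → (r + r) * (r + r) ≡ 4 * (r * r)
      quadruple = solve-∀
      square-of-sum : ∀ A T →
        4 * (A * (T * T)) + (T * T + 4 * (A * A * (T * T))) ≡ (((A + A) + 1) * T) * (((A + A) + 1) * T)
      square-of-sum = solve-∀

    ⌊√radicand⌋-error : ∀ {m} → m ≤ suc i → m * (X ∸ r * r) < T * T
    ⌊√radicand⌋-error {m} m≤1+i = begin-strict
      m * (X ∸ r * r)             ≤⟨ *-mono-≤ m≤1+i (floorSqrt-remainder (⌊√⌋-isFloorSqrt X)) ⟩
      suc i * (r + r)             <⟨ *-monoʳ-< (suc i) ⌊√radicand⌋-double< ⟩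
      suc i * (((A + A) + 1) * T) ≡⟨ reassociate i A T ⟩
      N * T                       ≤⟨ *-monoˡ-≤ T (m≤n*m N B) ⟩
      T * T                       ∎
      where
      open ≤-Reasoning
      reassociate : ∀ i A T → suc i * (((A + A) + 1) * T) ≡ (((A + A) + 1) * (i + 1)) * T
      reassociate = solve-∀

    ⌊√radicand⌋-close : ∀ {m} → m ≤ suc i → m * ∣ A * (T * T) - r * r * B ∣ < B * (T * T)
    ⌊√radicand⌋-close {m} m≤1+i = begin-strict
      m * ∣ A * (T * T) - r * r * B ∣ ≡⟨ cong (m *_) (cong₂ ∣_-_∣ (sym (radicand-identity i A B)) (*-comm (r * r) B)) ⟩
      m * ∣ B * X - B * (r * r) ∣     ≡⟨ cong (m *_) (sym (*-distribˡ-∣-∣ B X (r * r))) ⟩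
      m * (B * ∣ X - r * r ∣)         ≡⟨ cong (λ d → m * (B * d)) (m≤n⇒∣n-m∣≡n∸m (square≤ (⌊√⌋-isFloorSqrt X))) ⟩
      m * (B * (X ∸ r * r))           ≡⟨ *-comm-left m B (X ∸ r * r) ⟩
      B * (m * (X ∸ r * r))           <⟨ *-monoʳ-< B (⌊√radicand⌋-error m≤1+i) ⟩
      B * (T * T)                     ∎
      where
      open ≤-Reasoning
      *-comm-left : ∀ m B e → m * (B * e) ≡ B * (m * e)
      *-comm-left = solve-∀

  ∣u²-v²∣-bound : ∀ Q u v α β P² {E₁ E₂} → Q * (u * u) + E₁ ≡ α * P² → Q * (v * v) + E₂ ≡ β * P² →
    Q * ∣ u * u - v * v ∣ ≤ ∣ α - β ∣ * P² + (E₁ + E₂)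
  ∣u²-v²∣-bound Q u v α β P² {E₁} {E₂} eq₁ eq₂ = begin
    Q * ∣ u * u - v * v ∣                     ≡⟨ *-distribˡ-∣-∣ Q (u * u) (v * v) ⟩
    ∣ Q * (u * u) - Q * (v * v) ∣             ≤⟨ ∣m-n∣≤∣m+s-[n+t]∣+[s+t] (Q * (u * u)) (Q * (v * v)) E₁ E₂ ⟩
    ∣ Q * (u * u) + E₁ - (Q * (v * v) + E₂) ∣ + (E₁ + E₂) ≡⟨ cong (_+ (E₁ + E₂)) (cong₂ ∣_-_∣ eq₁ eq₂) ⟩
    ∣ α * P² - β * P² ∣ + (E₁ + E₂)           ≡⟨ cong (_+ (E₁ + E₂)) (sym (*-distribʳ-∣-∣ P² α β)) ⟩
    ∣ α - β ∣ * P² + (E₁ + E₂)                ∎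
    where open ≤-Reasoning

  -- With u = r₁ T₂, v = r₂ T₁, Q = B₁ B₂: Q |u² - v²| ≤ |A₁ B₂ - A₂ B₁| (T₁ T₂)² plus the two
  -- floor errors, each of the three terms less than Q (T₁ T₂)² / (3 m²).
  ⌊√radicand⌋-cauchy : ∀ m i₁ A₁ B₁ i₂ A₂ B₂ .{{B₁≢0 : NonZero B₁}} .{{B₂≢0 : NonZero B₂}} →
    3 * m * m ≤ suc i₁ → 3 * m * m ≤ suc i₂ → (3 * m * m) * ∣ A₁ * B₂ - A₂ * B₁ ∣ < B₁ * B₂ →
    m * ∣ ⌊√ radicand i₁ A₁ B₁ ⌋ * (B₂ * scale i₂ A₂) - ⌊√ radicand i₂ A₂ B₂ ⌋ * (B₁ * scale i₁ A₁) ∣ <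
      (B₁ * scale i₁ A₁) * (B₂ * scale i₂ A₂)
  ⌊√radicand⌋-cauchy m i₁ A₁ B₁ i₂ A₂ B₂ {{B₁≢0}} {{B₂≢0}} M≤1+i₁ M≤1+i₂ close =
    m*m<n*n⇒m<n _ _ (begin-strict
      (m * ∣ u - v ∣) * (m * ∣ u - v ∣) ≡⟨ square-of-product m ∣ u - v ∣ ⟩
      (m * m) * (∣ u - v ∣ * ∣ u - v ∣) ≤⟨ *-monoʳ-≤ (m * m) (∣m-n∣*∣m-n∣≤∣m*m-n*n∣ u v) ⟩
      (m * m) * W                       <⟨ *-cancelˡ-< (3 * Q) _ _ scaled ⟩
      P * P                             ∎)
    where
    open ≤-Reasoning
    M T₁ T₂ r₁ r₂ e₁ e₂ u v Q P W : ℕ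
    M = 3 * m * m
    T₁ = B₁ * scale i₁ A₁
    T₂ = B₂ * scale i₂ A₂
    r₁ = ⌊√ radicand i₁ A₁ B₁ ⌋
    r₂ = ⌊√ radicand i₂ A₂ B₂ ⌋
    e₁ = radicand i₁ A₁ B₁ ∸ r₁ * r₁
    e₂ = radicand i₂ A₂ B₂ ∸ r₂ * r₂
    u = r₁ * T₂
    v = r₂ * T₁
    Q = B₁ * B₂
    P = T₁ * T₂
    W = ∣ u * u - v * v ∣
    square-of-product : ∀ m x → (m * x) * (m * x) ≡ (m * m) * (x * x)
    square-of-product = solve-∀
    regroup₁ : ∀ B₁ B₂ r₁ T₂ e₁ →
      (B₁ * B₂) * ((r₁ * T₂) * (r₁ * T₂)) + (B₁ * B₂) * e₁ * (T₂ * T₂) ≡ B₂ * (T₂ * T₂) * (B₁ * (r₁ * r₁ + e₁))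
    regroup₁ = solve-∀
    regroup₂ : ∀ A₁ B₂ T₁ T₂ → B₂ * (T₂ * T₂) * (A₁ * (T₁ * T₁)) ≡ (A₁ * B₂) * ((T₁ * T₂) * (T₁ * T₂))
    regroup₂ = solve-∀
    regroup₃ : ∀ B₁ B₂ r₂ T₁ e₂ →
      (B₁ * B₂) * ((r₂ * T₁) * (r₂ * T₁)) + (B₁ * B₂) * e₂ * (T₁ * T₁) ≡ B₁ * (T₁ * T₁) * (B₂ * (r₂ * r₂ + e₂))
    regroup₃ = solve-∀
    regroup₄ : ∀ A₂ B₁ T₁ T₂ → B₁ * (T₁ * T₁) * (A₂ * (T₂ * T₂)) ≡ (A₂ * B₁) * ((T₁ * T₂) * (T₁ * T₂))
    regroup₄ = solve-∀
    regroup₅ : ∀ m Q W → (3 * Q) * ((m * m) * W) ≡ (3 * m * m) * (Q * W)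
    regroup₅ = solve-∀
    distribute : ∀ M D P² Q e₁ e₂ T₁² T₂² → M * (D * P² + (Q * e₁ * T₂² + Q * e₂ * T₁²)) ≡
      (M * D) * P² + (Q * (M * e₁) * T₂² + Q * (M * e₂) * T₁²)
    distribute = solve-∀
    triple : ∀ Q T₁ T₂ → Q * ((T₁ * T₂) * (T₁ * T₂)) + (Q * (T₁ * T₁) * (T₂ * T₂) + Q * (T₂ * T₂) * (T₁ * T₁)) ≡
      (3 * Q) * ((T₁ * T₂) * (T₁ * T₂))
    triple = solve-∀
    weighted₁ : Q * (u * u) + Q * e₁ * (T₂ * T₂) ≡ (A₁ * B₂) * (P * P)
    weighted₁ = begin-equality
      Q * (u * u) + Q * e₁ * (T₂ * T₂)        ≡⟨ regroup₁ B₁ B₂ r₁ T₂ e₁ ⟩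
      B₂ * (T₂ * T₂) * (B₁ * (r₁ * r₁ + e₁)) ≡⟨ cong (B₂ * (T₂ * T₂) *_) (⌊√radicand⌋-decomposition i₁ A₁ B₁) ⟩
      B₂ * (T₂ * T₂) * (A₁ * (T₁ * T₁))      ≡⟨ regroup₂ A₁ B₂ T₁ T₂ ⟩
      (A₁ * B₂) * (P * P)                     ∎
    weighted₂ : Q * (v * v) + Q * e₂ * (T₁ * T₁) ≡ (A₂ * B₁) * (P * P)
    weighted₂ = begin-equality
      Q * (v * v) + Q * e₂ * (T₁ * T₁)        ≡⟨ regroup₃ B₁ B₂ r₂ T₁ e₂ ⟩
      B₁ * (T₁ * T₁) * (B₂ * (r₂ * r₂ + e₂)) ≡⟨ cong (B₁ * (T₁ * T₁) *_) (⌊√radicand⌋-decomposition i₂ A₂ B₂) ⟩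
      B₁ * (T₁ * T₁) * (A₂ * (T₂ * T₂))      ≡⟨ regroup₄ A₂ B₁ T₁ T₂ ⟩
      (A₂ * B₁) * (P * P)                     ∎
    instance
      P²≢0 : NonZero (P * P)
      P²≢0 = m*n≢0 P P {{P≢0}} {{P≢0}}
        where
        T₁≢0 = m*n≢0 B₁ (scale i₁ A₁) {{B₁≢0}} {{scale-nonZero i₁ A₁}}
        T₂≢0 = m*n≢0 B₂ (scale i₂ A₂) {{B₂≢0}} {{scale-nonZero i₂ A₂}}
        P≢0 = m*n≢0 T₁ T₂ {{T₁≢0}} {{T₂≢0}}
    scaled : (3 * Q) * ((m * m) * W) < (3 * Q) * (P * P)
    scaled = begin-strict
      (3 * Q) * ((m * m) * W)                                             ≡⟨ regroup₅ m Q W ⟩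
      M * (Q * W)
        ≤⟨ *-monoʳ-≤ M (∣u²-v²∣-bound Q u v (A₁ * B₂) (A₂ * B₁) (P * P) weighted₁ weighted₂) ⟩
      M * (∣ A₁ * B₂ - A₂ * B₁ ∣ * (P * P) + (Q * e₁ * (T₂ * T₂) + Q * e₂ * (T₁ * T₁)))
        ≡⟨ distribute M ∣ A₁ * B₂ - A₂ * B₁ ∣ (P * P) Q e₁ e₂ (T₁ * T₁) (T₂ * T₂) ⟩
      (M * ∣ A₁ * B₂ - A₂ * B₁ ∣) * (P * P) + (Q * (M * e₁) * (T₂ * T₂) + Q * (M * e₂) * (T₁ * T₁))
        <⟨ +-mono-<-≤ (*-monoˡ-< (P * P) close) (+-mono-≤
             (*-monoˡ-≤ (T₂ * T₂) (*-monoʳ-≤ Q (<⇒≤ (⌊√radicand⌋-error i₁ A₁ B₁ M≤1+i₁))))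
             (*-monoˡ-≤ (T₁ * T₁) (*-monoʳ-≤ Q (<⇒≤ (⌊√radicand⌋-error i₂ A₂ B₂ M≤1+i₂))))) ⟩
      Q * (P * P) + (Q * (T₁ * T₁) * (T₂ * T₂) + Q * (T₂ * T₂) * (T₁ * T₁)) ≡⟨ triple Q T₁ T₂ ⟩
      (3 * Q) * (P * P)                                                   ∎

module StandardModel where
  open import Data.Nat
  open import Data.Nat.Properties
  open import Data.Nat.Tactic.RingSolver using (solve-∀)
  open import Function.Construct.Symmetry using (⇔-sym)
  open KM ℕ-str
  open GraphSemantics ℕ-str
  open Graphs ℕ-str
  open IsMRealSeq
  open SqrtEstimates
  open IsFloorSqrt

  closeBy⇔ : ∀ m a b a' b' → CloseBy m (false , a , b) (false , a' , b') ⇔ m * ∣ a * b' - a' * b ∣ < b * b'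
  closeBy⇔ m a b a' b' =
    ≡⇒⇔ (cong (_< b * b') (sym (*-distribˡ-∣-∣ m (a * b') (a' * b)))) ⇔-∘
    (⇔-sym (∣m-n∣<o⇔ (m * (a * b')) (m * (a' * b)) (b * b')) ⇔-∘ ≡⇒⇔ unfold)
    where
    cross : ∀ m a b' a' → m * ((a * b' + 0) + (a' * 0 + 0)) + 0 ≡ m * (a * b')
    cross = solve-∀
    cross' : ∀ m a b a' → m * ((a * 0 + 0) + (a' * b + 0)) + 0 ≡ m * (a' * b)
    cross' = solve-∀
    unfold : CloseBy m (false , a , b) (false , a' , b') ≡
      (m * (a' * b) < m * (a * b') + b * b' × m * (a * b') < b * b' + m * (a' * b))
    unfold = cong₂ _×_ (cong₂ _<_ (cross' m a b a') (cong (_+ b * b') (cross m a b' a')))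
                       (cong₂ _<_ (trans (+-identityʳ _) (cross m a b' a')) (cong (b * b' +_) (cross' m a b a')))

  ltBy-zero⇒nonnegative : ∀ {m σ a b} → LtBy m (false , 0 , 1) (σ , a , b) → σ ≡ false
  ltBy-zero⇒nonnegative {σ = false} _ = refl
  ltBy-zero⇒nonnegative {m} {true} {a} lt = ⊥-elim (m<n⇒n≢0 lt (vanishes m a))
    where
    vanishes : ∀ m a → (m * (a * 0) + 0) + ((m * 0 + 0) + 0) ≡ 0
    vanishes = solve-∀

  eventuallyNonnegative : ∀ {f} → zeroSeq <K f → Σ[ k ∈ ℕ ] ∀ l → k < l → proj₁ (f l) ≡ false
  eventuallyNonnegative {f} (m , k , _ , lt) = k , λ l k<l →
    ltBy-zero⇒nonnegative {m} {proj₁ (f l)} {proj₁ (proj₂ (f l))} {proj₂ (proj₂ (f l))} (lt l k<l)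

  -- The sign of c_i is ignored; c is eventually positive.
  sqrtEntry : ℕ → Entry → Entry
  sqrtEntry i (_ , A , B) = false , ⌊√ radicand i A B ⌋ , B * scale i A

  sqrtSeq : FracSeq → FracSeq
  sqrtSeq f i = sqrtEntry i (f i)

  sqrtEntry-close : ∀ m i₁ A₁ B₁ i₂ A₂ B₂ .{{_ : NonZero B₁}} .{{_ : NonZero B₂}} →
    3 * m * m ≤ suc i₁ → 3 * m * m ≤ suc i₂ → CloseBy (3 * m * m) (false , A₁ , B₁) (false , A₂ , B₂) →
    CloseBy m (sqrtEntry i₁ (false , A₁ , B₁)) (sqrtEntry i₂ (false , A₂ , B₂))
  sqrtEntry-close m i₁ A₁ B₁ i₂ A₂ B₂ M≤1+i₁ M≤1+i₂ close =
    from (closeBy⇔ m ⌊√ radicand i₁ A₁ B₁ ⌋ (B₁ * scale i₁ A₁) ⌊√ radicand i₂ A₂ B₂ ⌋ (B₂ * scale i₂ A₂))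
      (⌊√radicand⌋-cauchy m i₁ A₁ B₁ i₂ A₂ B₂ M≤1+i₁ M≤1+i₂ (to (closeBy⇔ (3 * m * m) A₁ B₁ A₂ B₂) close))

  sqrtEntry-approx : ∀ m i A B .{{_ : NonZero B}} → m ≤ suc i →
    CloseBy m (false , A , B) (false , ⌊√ radicand i A B ⌋ * ⌊√ radicand i A B ⌋ , (B * scale i A) * (B * scale i A))
  sqrtEntry-approx m i A B m≤1+i =
    from (closeBy⇔ m A B (⌊√ radicand i A B ⌋ * ⌊√ radicand i A B ⌋) ((B * scale i A) * (B * scale i A)))
      (⌊√radicand⌋-close i A B m≤1+i)

  module _ {f : FracSeq} (f-real : IsMRealSeq f) (f-pos : zeroSeq <K f) where

    numer : ℕ → ℕ
    numer i = proj₁ (proj₂ (f i))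
    denom : ℕ → ℕ
    denom i = proj₂ (proj₂ (f i))
    k₀ : ℕ
    k₀ = proj₁ (eventuallyNonnegative {f} f-pos)

    denom-nonZero : ∀ i → NonZero (denom i)
    denom-nonZero i = ≢-nonZero (nonzeroDenominators f-real i)

    entry-nonnegative : ∀ {l} → k₀ < l → f l ≡ (false , numer l , denom l)
    entry-nonnegative {l} k₀<l = cong (_, numer l , denom l) (proj₂ (eventuallyNonnegative {f} f-pos) l k₀<l)

    sqrtSeq-cauchy : Cauchy (sqrtSeq f)
    sqrtSeq-cauchy m 0<m = n ⊔ k₀ ⊔ M , λ k₁ k₂ n'<k₁ n'<k₂ →
      let n<k₁ = m⊔n<o⇒m<o n k₀ (m⊔n<o⇒m<o (n ⊔ k₀) M n'<k₁)
          n<k₂ = m⊔n<o⇒m<o n k₀ (m⊔n<o⇒m<o (n ⊔ k₀) M n'<k₂)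
          k₀<k₁ = m⊔n<o⇒n<o n k₀ (m⊔n<o⇒m<o (n ⊔ k₀) M n'<k₁)
          k₀<k₂ = m⊔n<o⇒n<o n k₀ (m⊔n<o⇒m<o (n ⊔ k₀) M n'<k₂)
          M≤1+k₁ = <⇒≤ (m<n⇒m<1+n (m⊔n<o⇒n<o (n ⊔ k₀) M n'<k₁))
          M≤1+k₂ = <⇒≤ (m<n⇒m<1+n (m⊔n<o⇒n<o (n ⊔ k₀) M n'<k₂))
      in sqrtEntry-close m k₁ (numer k₁) (denom k₁) k₂ (numer k₂) (denom k₂)
           {{denom-nonZero k₁}} {{denom-nonZero k₂}} M≤1+k₁ M≤1+k₂
           (subst₂ (CloseBy M) (entry-nonnegative k₀<k₁) (entry-nonnegative k₀<k₂) (close k₁ k₂ n<k₁ n<k₂))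
      where
      M : ℕ
      M = 3 * m * m
      0<M : 0 < M
      0<M = *-mono-≤ (*-mono-≤ (s≤s (z≤n {2})) 0<m) 0<m
      n : ℕ
      n = proj₁ (cauchySeq f-real M 0<M)
      close : ∀ k₁ k₂ → n < k₁ → n < k₂ → CloseBy M (f k₁) (f k₂)
      close = proj₂ (cauchySeq f-real M 0<M)

    sqrtSeq-isMRealSeq : IsMRealSeq (sqrtSeq f)
    sqrtSeq-isMRealSeq = record
      { canonicalSigns = λ _ _ _ ()
      ; nonzeroDenominators = λ i →
          ≢-nonZero⁻¹ _ {{m*n≢0 (denom i) (scale i (numer i)) {{denom-nonZero i}} {{scale-nonZero i (numer i)}}}}
      ; cauchySeq = sqrtSeq-cauchy
      }

    sqrtSeq-squareApproximates : f ≈K mulSeq (sqrtSeq f) (sqrtSeq f)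
    sqrtSeq-squareApproximates m 0<m = k₀ ⊔ m , λ l n<l →
      subst (λ e → CloseBy m e (mulSeq (sqrtSeq f) (sqrtSeq f) l)) (sym (entry-nonnegative (m⊔n<o⇒m<o k₀ m n<l)))
        (sqrtEntry-approx m l (numer l) (denom l) {{denom-nonZero l}} (<⇒≤ (m<n⇒m<1+n (m⊔n<o⇒n<o k₀ m n<l))))

  isSqrtEntry⇔ : ∀ i A B a b → IsSqrtEntry i A B a b ⇔ (a ≡ ⌊√ radicand i A B ⌋ × b ≡ B * scale i A)
  isSqrtEntry⇔ i A B a b = mk⇔ sound complete
    where
    X : ℕ
    X = radicand i A B
    sound : IsSqrtEntry i A B a b → a ≡ ⌊√ X ⌋ × b ≡ B * scale i A
    sound (b≡ , a²≤X , X<[a+1]²) =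
      isFloorSqrt-unique (isFloorSqrt ([ <⇒≤ , ≤-reflexive ]′ a²≤X)
        (subst (λ x → X < x * x) (+-comm a 1) X<[a+1]²)) (⌊√⌋-isFloorSqrt X) , b≡
    complete : a ≡ ⌊√ X ⌋ × b ≡ B * scale i A → IsSqrtEntry i A B a b
    complete (refl , refl) = refl , m≤n⇒m<n∨m≡n (square≤ (⌊√⌋-isFloorSqrt X)) ,
      subst (λ x → X < x * x) (sym (+-comm ⌊√ X ⌋ 1)) (<nextSquare (⌊√⌋-isFloorSqrt X))

  sqrtF-isGraph : ∀ {f k} (χ : Formula (4 + k)) (p : Vec ℕ k) →
    IsGraphOf f (definedBy χ p) → IsGraphOf (sqrtSeq f) (definedBy (sqrtF χ) p)
  sqrtF-isGraph {f} χ p f-graph i s a b = mk⇔ sound complete ⇔-∘ sat-sqrtF χ p i s a b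
    where
    sound : SqrtGraph (definedBy χ p) i s a b → Σ[ σ ∈ Bool ] s ≡ enc σ × sqrtSeq f i ≡ (σ , a , b)
    sound (s≡0 , cs , ca , cb , r , entry) =
      let _ , _ , eq = to (f-graph i cs ca cb) r
          a≡ , b≡ = to (isSqrtEntry⇔ i ca cb a b) entry
      in false , s≡0 , trans (cong (sqrtEntry i) eq) (cong₂ (λ x y → false , x , y) (sym a≡) (sym b≡))
    complete : ∀ {s a b} → Σ[ σ ∈ Bool ] s ≡ enc σ × sqrtSeq f i ≡ (σ , a , b) → SqrtGraph (definedBy χ p) i s a b
    complete (_ , s≡0 , refl) = s≡0 , _ , _ , _ , graph-at f-graph refl ,
      from (isSqrtEntry⇔ i (proj₁ (proj₂ (f i))) (proj₂ (proj₂ (f i))) _ _) (refl , refl)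

  sqrtSentence-holdsInℕ : ∀ {k} (χ : Formula (4 + k)) → Semantics._⊨_ ℕ-str (sqrtSentence χ)
  sqrtSentence-holdsInℕ χ = from (sat-sqrtSentence χ) λ p (χ-real , χ-pos) →
    let open GraphSequence χ-real
        f-pos = from (positive⇔ 0≢1+n graphSeq-isGraph) χ-pos
        d-graph = sqrtF-isGraph χ p graphSeq-isGraph
    in graph-isMRealGraph 0≢1+n d-graph (sqrtSeq-isMRealSeq graphSeq-isMRealSeq f-pos) ,
       to (squareApprox⇔ 0≢1+n graphSeq-isGraph d-graph) (sqrtSeq-squareApproximates graphSeq-isMRealSeq f-pos)

module Transfer (M : Structure) (M⊨Thℕ : ModelsThℕ M) where
  open Structure M
  open Semantics M
  open KM M
  open GraphSemantics M
  open Graphs M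

  𝟘≢𝟙 : ¬ 𝟘 ≡ 𝟙
  𝟘≢𝟙 = M⊨Thℕ ((zer ≐ one) ⇒f ⊥f) (λ ())

  -- Definability constrains φ only at sign codes of the form enc σ.
  withSignBit : ∀ {k} → Formula (4 ℕ.+ k) → Formula (4 ℕ.+ k)
  withSignBit φ = φ ∧f ((var# 1 ≐ zer) ∨f (var# 1 ≐ one))

  definable-isGraph : ∀ {f k} {p : Vec Carrier k} {φ : Formula (4 ℕ.+ k)} →
    (∀ i σ a b → (Sat φ (i ∷ enc σ ∷ a ∷ b ∷ p) → f i ≡ (σ , a , b)) ×
                 (f i ≡ (σ , a , b) → Sat φ (i ∷ enc σ ∷ a ∷ b ∷ p))) →
    IsGraphOf f (definedBy (withSignBit φ) p)
  definable-isGraph {f} {p = p} {φ} φ-defines i s a b = mk⇔ sound complete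
    where
    sound : Sat φ (i ∷ s ∷ a ∷ b ∷ p) × (s ≡ 𝟘 ⊎ s ≡ 𝟙) → Σ[ σ ∈ Bool ] s ≡ enc σ × f i ≡ (σ , a , b)
    sound (sat , bit) = let σ , s≡encσ = decodeSign bit in
      σ , s≡encσ , proj₁ (φ-defines i σ a b) (subst (λ x → Sat φ (i ∷ x ∷ a ∷ b ∷ p)) s≡encσ sat)
    complete : Σ[ σ ∈ Bool ] s ≡ enc σ × f i ≡ (σ , a , b) → Sat φ (i ∷ s ∷ a ∷ b ∷ p) × (s ≡ 𝟘 ⊎ s ≡ 𝟙)
    complete (σ , refl , eq) = proj₂ (φ-defines i σ a b) eq , enc-bit σ

  positiveSqrt : (c : MReal) → zeroSeq <K seq c → Σ[ d ∈ MReal ] seq c ≈K mulSeq (seq d) (seq d)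
  positiveSqrt c 0<c =
    let k , p , φ , φ-defines = definable c
        χ = withSignBit φ
        c-graph = definable-isGraph {p = p} {φ} φ-defines
        d-real , approx = to (sat-sqrtSentence χ) (M⊨Thℕ (sqrtSentence χ) (StandardModel.sqrtSentence-holdsInℕ χ)) p
          (graph-isMRealGraph 𝟘≢𝟙 c-graph (isMRealSeq c) , to (positive⇔ 𝟘≢𝟙 c-graph) 0<c)
        open GraphSequence d-real
    in mreal 𝟘≢𝟙 (sqrtF χ) p graphSeq-isGraph graphSeq-isMRealSeq ,
       from (squareApprox⇔ 𝟘≢𝟙 c-graph graphSeq-isGraph) approx

mainTheorem11 : (M : Structure) → ModelsThℕ M → (c : KM.MReal M) →
    KM._<K_ M (KM.zeroSeq M) (KM.MReal.seq c) →
    Σ (KM.MReal M) λ d →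
    KM._≈K_ M (KM.MReal.seq c) (KM.mulSeq M (KM.MReal.seq d) (KM.MReal.seq d))
mainTheorem11 M M⊨Thℕ = Transfer.positiveSqrt M M⊨Thℕ
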